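{- Let $f:\mathbb{N}\to\mathbb{C}$ be an arbitrary arithmetic function. Then for every positive integer $k$, \[ \sum_{j=1}^k f(\gcd(j,k))\, c_k(j) = \varphi(k)\,(\mu*f)(k), \] where $(\mu*f)(k)=\sum_{d\mid k}\mu(k/d)f(d)$.
   Context: For $k\in\mathbb{N}$ and $j\in\mathbb{Z}$, $c_k(j)=\sum_{1\le m\le k,\ \gcd(m,k)=1}\exp(2\pi i m j/k)$ is the Ramanujan sum. $\varphi$ is Euler's totient function, $\mu$ the Möbius function, and $*$ denotes Dirichlet convolution. -}

module Defs where

open import Level using (Level)
open import Algebra.Bundles using (CommutativeRing)
open import Data.Nat as ℕ using (ℕ; zero; suc; _<_)
open import Data.Nat.GCD using (gcd)
open import Data.Nat.Divisibility using (_∣?_)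
open import Data.Nat.Primality using (prime?)
open import Data.List using (List; []; _∷_; map; upTo; filter; length)
open import Data.List.Relation.Unary.Any using (any?)
open import Data.Integer as ℤ using (ℤ; +_; -[1+_])
open import Data.Bool using (if_then_else_)
open import Data.Product using (_×_)
open import Relation.Nullary using (¬_; does)
open import Relation.Nullary.Decidable using (_×-dec_)

range1 : ℕ → List ℕ
range1 k = map suc (upTo k)

totient : ℕ → ℕ
totient k = length (filter (λ m → gcd m k ℕ.≟ 1) (range1 k))

ω : ℕ → ℕ
ω n = length (filter (λ p → prime? p ×-dec (p ∣? n)) (range1 n))

sign : ℕ → ℤ
sign zero = + 1
sign (suc n) = ℤ.- sign n

mobius : ℕ → ℤ
mobius n = if does (any? (λ p → prime? p ×-dec ((p ℕ.* p) ∣? n)) (range1 n))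
           then + 0 else sign (ω n)

module _ {c ℓ : Level} (R : CommutativeRing c ℓ) where
  open CommutativeRing R

  ΣR : {A : Set} → List A → (A → Carrier) → Carrier
  ΣR [] g = 0#
  ΣR (x ∷ xs) g = g x + ΣR xs g

  _·ℕ_ : ℕ → Carrier → Carrier
  zero ·ℕ x = 0#
  suc n ·ℕ x = x + (n ·ℕ x)

  ιℤ : ℤ → Carrier
  ιℤ (+ n) = n ·ℕ 1#
  ιℤ -[1+ n ] = - (suc n ·ℕ 1#)

  pow : Carrier → ℕ → Carrier
  pow x zero = 1#
  pow x (suc n) = x * pow x n

  IsPrimitiveRoot : Carrier → ℕ → Set ℓ
  IsPrimitiveRoot ζ k = (pow ζ k ≈ 1#) × (∀ d → 0 < d → d < k → ¬ (pow ζ d ≈ 1#))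

  NoZeroDivisors : Set (c Level.⊔ ℓ)
  NoZeroDivisors = ∀ x y → x * y ≈ 0# → Data.Sum._⊎_ (x ≈ 0#) (y ≈ 0#)
    where import Data.Sum

  -- Ramanujan sum c_k(j) = Σ_{1≤m≤k, gcd(m,k)=1} ζ^{m j}, with ζ = e^{2πi/k}
  ramanujan : Carrier → ℕ → ℕ → Carrier
  ramanujan ζ k j = ΣR (filter (λ m → gcd m k ℕ.≟ 1) (range1 k)) (λ m → pow ζ (m ℕ.* j))

  mobiusConv : (ℕ → Carrier) → ℕ → Carrier
  mobiusConv f k = ΣR (filter (λ i → suc i ∣? k) (upTo k))
                      (λ i → ιℤ (mobius (k ℕ./ suc i)) * f (suc i))

module Submission where

-- Let g = μ ∗ f, so that f n = Σ_{d ∣ n} g d by Möbius inversion, and hence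
-- f (gcd j k) = Σ_{d ∣ j, d ∣ k} g d. For a primitive k-th root of unity ξ and a divisor d of k,
-- the sum of ξ^j over the multiples j ≤ k of d is a geometric sum in ξ^d, which vanishes unless
-- d = k (this is where the absence of zero divisors is used). Therefore
-- Σ_{j ≤ k} f (gcd j k) ξ^j = g k for every primitive ξ. Since c_k(j) = Σ_{m ⊥ k} (ζ^m)^j and each
-- ζ^m with m ⊥ k is again a primitive k-th root of unity, the left-hand side equals φ(k) · g k.

open import Defs
open import Level using (Level; 0ℓ)
open import Algebra.Bundles using (CommutativeRing; CommutativeSemiring)
import Algebra.Properties.CommutativeSemigroup as CommutativeSemigroupProperties
open import Data.Bool using (if_then_else_)
open import Data.Empty using (⊥-elim)
open import Data.Integer as ℤ using (+_; -[1+_])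
open import Data.List using (List; []; _∷_; [_]; _++_; map; upTo; filter; length)
import Data.List.Properties as List
open import Data.List.Relation.Unary.All using (_∷_)
open import Data.List.Relation.Unary.Any using (Any; any?; satisfied)
import Data.List.Relation.Unary.Any.Properties as AnyP
open import Data.Nat as ℕ using (ℕ; zero; suc; _≤_; _<_; z≤n; s≤s; _≟_; _%_; _/_)
open import Data.Nat.Coprimality as Coprime using (Coprime; coprime-divisor; gcd≡1⇒coprime)
open import Data.Nat.Divisibility
  using (_∣_; _∣?_; divides; ∣-refl; ∣-reflexive; ∣-trans; ∣⇒≤; >⇒∤; m%n≡0⇒n∣m; n∣m*n; m∣m*n; m*n∣⇒m∣;
         ∣n⇒∣m*n; ∣m⇒∣m*n; ∣m∣n⇒∣m+n; ∣m+n∣m⇒∣n; *-cancelˡ-∣; *-cancelʳ-∣; *-monoʳ-∣; *-monoˡ-∣)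
open import Data.Nat.DivMod using (m≡m%n+[m/n]*n; m%n<n; m*n/n≡m)
open import Data.Nat.GCD using (gcd; gcd[m,n]∣m; gcd[m,n]∣n; gcd[m,n]≢0; gcd-greatest)
open import Data.Nat.Primality using (Prime; prime?; prime⇒nonZero; prime⇒irreducible; ¬prime[1]; euclidsLemma)
open import Data.Nat.Primality.Factorisation using (factorise)
import Data.Nat.Properties as ℕ
open import Data.Product using (_×_; _,_; proj₁; proj₂; ∃)
open import Data.Sum using (_⊎_; inj₁; inj₂; [_,_]′)
open import Function using (_∘_; id)
open import Relation.Binary.PropositionalEquality as ≡ using (_≡_)
open import Relation.Nullary using (Dec; yes; no; ¬_; contradiction)
open import Relation.Nullary.Decidable using (_×-dec_; ¬?; dec-true; dec-false)
open import Relation.Unary using (Pred; Decidable)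

module FiniteSums {c ℓ} (S : CommutativeSemiring c ℓ) where
  open CommutativeSemiring S
  open CommutativeSemigroupProperties +-commutativeSemigroup using (interchange)
  open import Relation.Binary.Reasoning.Setoid setoid

  -- ∑[ i ≤ n ] h i = h 1 + ⋯ + h n; like range1, the index starts at 1.
  infix 5 ∑
  ∑ : ℕ → (ℕ → Carrier) → Carrier
  ∑ zero    h = 0#
  ∑ (suc n) h = ∑ n h + h (suc n)
  syntax ∑ n (λ i → e) = ∑[ i ≤ n ] e

  𝟙 : ∀ {p} {P : Set p} → Dec P → Carrier
  𝟙 (yes _) = 1#
  𝟙 (no _)  = 0#

  ∑-cong : ∀ n {h h′ : ℕ → Carrier} → (∀ i → 1 ≤ i → i ≤ n → h i ≈ h′ i) → ∑ n h ≈ ∑ n h′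
  ∑-cong zero    eq = refl
  ∑-cong (suc n) eq = +-cong (∑-cong n (λ i 1≤i i≤n → eq i 1≤i (ℕ.m≤n⇒m≤1+n i≤n))) (eq (suc n) (s≤s z≤n) ℕ.≤-refl)

  ∑-≡ : ∀ {m n} h → m ≡ n → ∑ m h ≈ ∑ n h
  ∑-≡ h ≡.refl = refl

  ∑-zero : ∀ n {h : ℕ → Carrier} → (∀ i → 1 ≤ i → i ≤ n → h i ≈ 0#) → ∑ n h ≈ 0#
  ∑-zero n eq = trans (∑-cong n eq) (∑-const-0 n)
    where
    ∑-const-0 : ∀ n → ∑[ i ≤ n ] 0# ≈ 0#
    ∑-const-0 zero    = refl
    ∑-const-0 (suc n) = trans (+-identityʳ _) (∑-const-0 n)

  ∑-distrib-+ : ∀ n (h h′ : ℕ → Carrier) → ∑[ i ≤ n ] (h i + h′ i) ≈ ∑ n h + ∑ n h′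
  ∑-distrib-+ zero    h h′ = sym (+-identityˡ 0#)
  ∑-distrib-+ (suc n) h h′ = trans (+-congʳ (∑-distrib-+ n h h′)) (interchange _ _ _ _)

  *-distribˡ-∑ : ∀ n x (h : ℕ → Carrier) → x * ∑ n h ≈ ∑[ i ≤ n ] x * h i
  *-distribˡ-∑ zero    x h = zeroʳ x
  *-distribˡ-∑ (suc n) x h = trans (distribˡ x _ _) (+-congʳ (*-distribˡ-∑ n x h))

  *-distribʳ-∑ : ∀ n x (h : ℕ → Carrier) → ∑ n h * x ≈ ∑[ i ≤ n ] h i * x
  *-distribʳ-∑ zero    x h = zeroˡ x
  *-distribʳ-∑ (suc n) x h = trans (distribʳ x _ _) (+-congʳ (*-distribʳ-∑ n x h))

  ∑-comm : ∀ m n (h : ℕ → ℕ → Carrier) → ∑[ i ≤ m ] ∑[ j ≤ n ] h i j ≈ ∑[ j ≤ n ] ∑[ i ≤ m ] h i j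
  ∑-comm zero    n h = sym (∑-zero n (λ _ _ _ → refl))
  ∑-comm (suc m) n h = trans (+-congʳ (∑-comm m n h)) (sym (∑-distrib-+ n _ _))

  ∑-+ : ∀ m n (h : ℕ → Carrier) → ∑ (m ℕ.+ n) h ≈ ∑ m h + (∑[ i ≤ n ] h (m ℕ.+ i))
  ∑-+ m zero    h rewrite ℕ.+-identityʳ m = sym (+-identityʳ _)
  ∑-+ m (suc n) h rewrite ℕ.+-suc m n = trans (+-congʳ (∑-+ m n h)) (+-assoc _ _ _)

  ∑-truncate : ∀ {m n} (h : ℕ → Carrier) → m ≤ n → (∀ i → m < i → h i ≈ 0#) → ∑ n h ≈ ∑ m h
  ∑-truncate {m} {n} h m≤n vanish = begin
    ∑ n h                                     ≈⟨ ∑-≡ h (≡.sym (ℕ.m+[n∸m]≡n m≤n)) ⟩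
    ∑ (m ℕ.+ (n ℕ.∸ m)) h                     ≈⟨ ∑-+ m (n ℕ.∸ m) h ⟩
    ∑ m h + (∑[ i ≤ n ℕ.∸ m ] h (m ℕ.+ i))    ≈⟨ +-congˡ (∑-zero (n ℕ.∸ m) (λ i 1≤i _ → vanish (m ℕ.+ i) (ℕ.m<m+n m 1≤i))) ⟩
    ∑ m h + 0#                                ≈⟨ +-identityʳ _ ⟩
    ∑ m h                                     ∎

  ∑-last : ∀ n (h : ℕ → Carrier) → (∀ i → 1 ≤ i → i ≤ n → h i ≈ 0#) → ∑ (suc n) h ≈ h (suc n)
  ∑-last n h vanish = trans (+-congʳ (∑-zero n vanish)) (+-identityˡ _)

  module _ {p} {P : Set p} where

    𝟙-*-yes : (d : Dec P) → P → ∀ x → 𝟙 d * x ≈ x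
    𝟙-*-yes (yes _) _  x = *-identityˡ x
    𝟙-*-yes (no ¬p) p  x = contradiction p ¬p

    𝟙-no : (d : Dec P) → ¬ P → 𝟙 d ≈ 0#
    𝟙-no (yes p) ¬p = contradiction p ¬p
    𝟙-no (no _)  _  = refl

    𝟙-*-no : (d : Dec P) → ¬ P → ∀ x → 𝟙 d * x ≈ 0#
    𝟙-*-no d ¬p x = trans (*-congʳ (𝟙-no d ¬p)) (zeroˡ x)

    𝟙-split : (d : Dec P) → ∀ x → x ≈ 𝟙 d * x + 𝟙 (¬? d) * x
    𝟙-split (yes _) x = sym (trans (+-cong (*-identityˡ x) (zeroˡ x)) (+-identityʳ x))
    𝟙-split (no _)  x = sym (trans (+-cong (zeroˡ x) (*-identityˡ x)) (+-identityˡ x))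

    𝟙-cong : ∀ {q} {Q : Set q} (d : Dec P) (e : Dec Q) → (P → Q) → (Q → P) → 𝟙 d ≈ 𝟙 e
    𝟙-cong (yes p) (yes q) _ _ = refl
    𝟙-cong (no _)  (no _)  _ _ = refl
    𝟙-cong (yes p) (no ¬q) f _ = contradiction (f p) ¬q
    𝟙-cong (no ¬p) (yes q) _ g = contradiction (g q) ¬p

    𝟙-× : ∀ {q} {Q : Set q} (d : Dec P) (e : Dec Q) → 𝟙 (d ×-dec e) ≈ 𝟙 d * 𝟙 e
    𝟙-× (yes _) (yes _) = sym (*-identityˡ 1#)
    𝟙-× (yes _) (no _)  = sym (zeroʳ 1#)
    𝟙-× (no _)  e       = sym (zeroˡ (𝟙 e))

  ∑-delta : ∀ n (h : ℕ → Carrier) → ∑[ i ≤ suc n ] 𝟙 (i ≟ suc n) * h i ≈ h (suc n)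
  ∑-delta n h = trans (∑-last n _ (λ i _ i≤n → 𝟙-*-no (i ≟ suc n) (ℕ.<⇒≢ (s≤s i≤n)) (h i)))
                      (𝟙-*-yes (suc n ≟ suc n) ≡.refl (h (suc n)))

  ∑-multiples : ∀ {d} N (h : ℕ → Carrier) → 1 ≤ d → ∑[ i ≤ N ℕ.* d ] 𝟙 (d ∣? i) * h i ≈ ∑[ c ≤ N ] h (c ℕ.* d)
  ∑-multiples         zero    h _   = refl
  ∑-multiples {suc e} (suc N) h 1≤d = begin
    ∑ (d ℕ.+ N ℕ.* d) g                               ≈⟨ ∑-≡ g (ℕ.+-comm d (N ℕ.* d)) ⟩
    ∑ (N ℕ.* d ℕ.+ d) g                               ≈⟨ ∑-+ (N ℕ.* d) d g ⟩
    ∑ (N ℕ.* d) g + (∑[ r ≤ d ] g (N ℕ.* d ℕ.+ r))    ≈⟨ +-cong (∑-multiples N h 1≤d) lastBlock ⟩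
    (∑[ c ≤ N ] h (c ℕ.* d)) + h (suc N ℕ.* d)        ∎
    where
    d = suc e
    g = λ i → 𝟙 (d ∣? i) * h i
    lastBlock : ∑[ r ≤ d ] g (N ℕ.* d ℕ.+ r) ≈ h (suc N ℕ.* d)
    lastBlock = begin
      ∑[ r ≤ d ] g (N ℕ.* d ℕ.+ r) ≈⟨ ∑-last e _ (λ r 1≤r r≤e → 𝟙-*-no (d ∣? N ℕ.* d ℕ.+ r)
                                       (λ d∣ → ℕ.<⇒≱ (s≤s r≤e) (∣⇒≤ ⦃ ℕ.>-nonZero 1≤r ⦄ (∣m+n∣m⇒∣n d∣ (n∣m*n N)))) _) ⟩
      g (N ℕ.* d ℕ.+ d)            ≈⟨ 𝟙-*-yes (d ∣? N ℕ.* d ℕ.+ d) (∣m∣n⇒∣m+n (n∣m*n N) ∣-refl) _ ⟩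
      h (N ℕ.* d ℕ.+ d)            ≡⟨ ≡.cong h (ℕ.+-comm (N ℕ.* d) d) ⟩
      h (suc N ℕ.* d)              ∎

  ∑-divisors-truncate : ∀ {n K} (h : ℕ → Carrier) → 1 ≤ n → n ≤ K →
                        ∑[ i ≤ K ] 𝟙 (i ∣? n) * h i ≈ ∑[ i ≤ n ] 𝟙 (i ∣? n) * h i
  ∑-divisors-truncate h 1≤n n≤K = ∑-truncate _ n≤K (λ i n<i → 𝟙-*-no (i ∣? _) (>⇒∤ ⦃ ℕ.>-nonZero 1≤n ⦄ n<i) (h i))

range1-suc : ∀ n → range1 (suc n) ≡ range1 n ++ [ suc n ]
range1-suc n = ≡.trans (≡.cong (map suc) (≡.sym (List.upTo-∷ʳ n))) (List.map-++ suc (upTo n) [ n ])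

module _ where
  open FiniteSums ℕ.+-*-commutativeSemiring
  open ≡.≡-Reasoning

  length-filter-range1 : ∀ {p} {P : ℕ → Set p} (P? : Decidable P) n →
                         length (filter P? (range1 n)) ≡ ∑[ i ≤ n ] 𝟙 (P? i)
  length-filter-range1 P? zero    = ≡.refl
  length-filter-range1 P? (suc n) = begin
    length (filter P? (range1 (suc n)))                     ≡⟨ ≡.cong (length ∘ filter P?) (range1-suc n) ⟩
    length (filter P? (range1 n ++ [ suc n ]))              ≡⟨ ≡.cong length (List.filter-++ P? (range1 n) _) ⟩
    length (filter P? (range1 n) ++ filter P? [ suc n ])    ≡⟨ List.length-++ (filter P? (range1 n)) ⟩
    length (filter P? (range1 n)) ℕ.+ length (filter P? [ suc n ])
                                                            ≡⟨ ≡.cong₂ ℕ._+_ (length-filter-range1 P? n) (length-filter-[x] (suc n)) ⟩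
    ∑ n (𝟙 ∘ P?) ℕ.+ 𝟙 (P? (suc n))                         ∎
    where
    length-filter-[x] : ∀ x → length (filter P? [ x ]) ≡ 𝟙 (P? x)
    length-filter-[x] x with P? x
    ... | yes _ = ≡.refl
    ... | no _  = ≡.refl

  ∑-𝟙-≟ : ∀ n → 1 ≤ n → ∑[ i ≤ n ] 𝟙 (i ≟ n) ≡ 1
  ∑-𝟙-≟ (suc n) _ = ≡.trans (∑-cong (suc n) (λ i _ _ → ≡.sym (ℕ.*-identityʳ _))) (∑-delta n (λ _ → 1))

-- Prime divisors and the Möbius function

quotient-pos : ∀ {n q d} → 1 ≤ n → n ≡ q ℕ.* d → 1 ≤ q
quotient-pos {q = zero}  (s≤s z≤n) ()
quotient-pos {q = suc q} _         _  = s≤s z≤n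

prime⇒1≤ : ∀ {p} → Prime p → 1 ≤ p
prime⇒1≤ {p} p-prime = ℕ.>-nonZero⁻¹ p ⦃ prime⇒nonZero p-prime ⦄

prime∣prime⇒≡ : ∀ {p q} → Prime p → Prime q → q ∣ p → q ≡ p
prime∣prime⇒≡ p-prime q-prime q∣p with prime⇒irreducible p-prime q∣p
... | inj₁ ≡.refl = contradiction q-prime ¬prime[1]
... | inj₂ q≡p    = q≡p

prime∤⇒coprime : ∀ {p n} → Prime p → ¬ p ∣ n → Coprime p n
prime∤⇒coprime p-prime p∤n (d∣p , d∣n) with prime⇒irreducible p-prime d∣p
... | inj₁ d≡1    = d≡1
... | inj₂ ≡.refl = contradiction d∣n p∤n

∃-prime-divisor : ∀ n → ∃ λ p → Prime p × p ∣ suc (suc n)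
∃-prime-divisor n with factorise (suc (suc n))
... | record { factors = [] ; isFactorisation = () }
... | record { factors = p ∷ _ ; isFactorisation = eq ; factorsPrime = p-prime ∷ _ } =
  p , p-prime , ≡.subst (p ∣_) (≡.sym eq) (m∣m*n _)

any-range1 : ∀ {p} {P : Pred ℕ p} {n q} → 1 ≤ q → q ≤ n → P q → Any P (range1 n)
any-range1 {q = suc q} _ q<n Pq = AnyP.map⁺ (AnyP.applyUpTo⁺ id Pq q<n)

-- ω n and mobius n unfold to a filter with primeDivisor? n and a search with squareDivisor? n.
primeDivisor? : ∀ n → Decidable (λ q → Prime q × q ∣ n)
primeDivisor? n q = prime? q ×-dec (q ∣? n)

SquareDivisor : ℕ → Pred ℕ 0ℓ
SquareDivisor n q = Prime q × q ℕ.* q ∣ n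

squareDivisor? : ∀ n → Decidable (SquareDivisor n)
squareDivisor? n q = prime? q ×-dec (q ℕ.* q ∣? n)

Squarefree : ℕ → Set
Squarefree n = ∀ {q} → ¬ SquareDivisor n q

squareDivisor∈range1 : ∀ {n q} → 1 ≤ n → SquareDivisor n q → Any (SquareDivisor n) (range1 n)
squareDivisor∈range1 {n} {q} 1≤n sq@(q-prime , q²∣n) =
  any-range1 (prime⇒1≤ q-prime) (∣⇒≤ ⦃ ℕ.>-nonZero 1≤n ⦄ (m*n∣⇒m∣ q q q²∣n)) sq

squareful-or-squarefree : ∀ n → 1 ≤ n → ∃ (SquareDivisor n) ⊎ Squarefree n
squareful-or-squarefree n 1≤n with any? (squareDivisor? n) (range1 n)
... | yes some = inj₁ (satisfied some)
... | no none  = inj₂ (none ∘ squareDivisor∈range1 1≤n)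

mobius-squareful : ∀ {n q} → 1 ≤ n → SquareDivisor n q → mobius n ≡ + 0
mobius-squareful {n} 1≤n sq = ≡.cong (λ b → if b then + 0 else sign (ω n))
  (dec-true (any? (squareDivisor? n) (range1 n)) (squareDivisor∈range1 1≤n sq))

mobius-squarefree : ∀ {n} → Squarefree n → mobius n ≡ sign (ω n)
mobius-squarefree {n} sf = ≡.cong (λ b → if b then + 0 else sign (ω n))
  (dec-false (any? (squareDivisor? n) (range1 n)) (sf ∘ proj₂ ∘ satisfied))

mobius-*-∣ : ∀ {p c} → Prime p → p ∣ c → 1 ≤ c → mobius (p ℕ.* c) ≡ + 0
mobius-*-∣ {p} p-prime p∣c 1≤c =
  mobius-squareful (ℕ.*-mono-≤ (prime⇒1≤ p-prime) 1≤c) (p-prime , *-monoʳ-∣ p p∣c)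

module _ {p c : ℕ} (p-prime : Prime p) (p∤c : ¬ p ∣ c) where
  open FiniteSums ℕ.+-*-commutativeSemiring

  squareDivisor-*-prime : ∀ {q} → SquareDivisor (p ℕ.* c) q → SquareDivisor c q
  squareDivisor-*-prime {q} (q-prime , q²∣pc) with q ≟ p
  ... | yes ≡.refl = contradiction (*-cancelˡ-∣ q ⦃ prime⇒nonZero q-prime ⦄ q²∣pc) p∤c
  ... | no q≢p     = q-prime , coprime-divisor (Coprime.sym (prime∤⇒coprime p-prime p∤q²)) q²∣pc
    where
    p∤q² : ¬ p ∣ q ℕ.* q
    p∤q² p∣q² = q≢p (≡.sym (prime∣prime⇒≡ q-prime p-prime
                  ([ id , id ]′ (euclidsLemma q q p-prime p∣q²))))

  𝟙-primeDivisor-* : ∀ q → 𝟙 (primeDivisor? (p ℕ.* c) q) ≡ 𝟙 (primeDivisor? c q) ℕ.+ 𝟙 (q ≟ p)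
  𝟙-primeDivisor-* q with prime? q | q ∣? p ℕ.* c | q ∣? c | q ≟ p
  ... | yes _       | _        | yes q∣c | yes ≡.refl = contradiction q∣c p∤c
  ... | yes _       | yes _    | yes _   | no _       = ≡.refl
  ... | yes _       | yes _    | no _    | yes _      = ≡.refl
  ... | yes q-prime | yes q∣pc | no q∤c  | no q≢p     =
    ⊥-elim ([ q≢p ∘ prime∣prime⇒≡ p-prime q-prime , q∤c ]′ (euclidsLemma p c q-prime q∣pc))
  ... | yes _       | no q∤pc  | yes q∣c | _          = contradiction (∣n⇒∣m*n p q∣c) q∤pc
  ... | yes _       | no q∤pc  | no _    | yes ≡.refl = contradiction (m∣m*n c) q∤pc
  ... | yes _       | no _     | no _    | no _       = ≡.refl
  ... | no ¬q-prime | _        | _       | yes ≡.refl = contradiction p-prime ¬q-prime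
  ... | no _        | _        | _       | no _       = ≡.refl

  ω-*-prime : 1 ≤ c → ω (p ℕ.* c) ≡ suc (ω c)
  ω-*-prime 1≤c = begin
    ω (p ℕ.* c)
      ≡⟨ length-filter-range1 (primeDivisor? (p ℕ.* c)) (p ℕ.* c) ⟩
    ∑[ q ≤ p ℕ.* c ] 𝟙 (primeDivisor? (p ℕ.* c) q)
      ≡⟨ ∑-cong (p ℕ.* c) (λ q _ _ → 𝟙-primeDivisor-* q) ⟩
    ∑[ q ≤ p ℕ.* c ] (𝟙 (primeDivisor? c q) ℕ.+ 𝟙 (q ≟ p))
      ≡⟨ ∑-distrib-+ (p ℕ.* c) _ _ ⟩
    (∑[ q ≤ p ℕ.* c ] 𝟙 (primeDivisor? c q)) ℕ.+ (∑[ q ≤ p ℕ.* c ] 𝟙 (q ≟ p))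
      ≡⟨ ≡.cong₂ ℕ._+_ (∑-truncate _ c≤pc (λ q c<q → 𝟙-no (primeDivisor? c q) (ℕ.<⇒≱ c<q ∘ ∣⇒≤ ⦃ ℕ.>-nonZero 1≤c ⦄ ∘ proj₂)))
                       (∑-truncate _ p≤pc (λ q p<q → 𝟙-no (q ≟ p) (ℕ.<⇒≢ p<q ∘ ≡.sym))) ⟩
    (∑[ q ≤ c ] 𝟙 (primeDivisor? c q)) ℕ.+ (∑[ q ≤ p ] 𝟙 (q ≟ p))
      ≡⟨ ≡.cong₂ ℕ._+_ (≡.sym (length-filter-range1 (primeDivisor? c) c)) (∑-𝟙-≟ p (prime⇒1≤ p-prime)) ⟩
    ω c ℕ.+ 1
      ≡⟨ ℕ.+-comm (ω c) 1 ⟩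
    suc (ω c) ∎
    where
    open ≡.≡-Reasoning
    c≤pc : c ≤ p ℕ.* c
    c≤pc = ℕ.m≤n*m c p ⦃ prime⇒nonZero p-prime ⦄
    p≤pc : p ≤ p ℕ.* c
    p≤pc = ℕ.m≤m*n p c ⦃ ℕ.>-nonZero 1≤c ⦄

  mobius-*-prime : 1 ≤ c → mobius (p ℕ.* c) ≡ ℤ.- mobius c
  mobius-*-prime 1≤c with squareful-or-squarefree c 1≤c
  ... | inj₁ (q , q-prime , q²∣c) =
    ≡.trans (mobius-squareful (ℕ.*-mono-≤ (prime⇒1≤ p-prime) 1≤c) (q-prime , ∣n⇒∣m*n p q²∣c))
            (≡.cong ℤ.-_ (≡.sym (mobius-squareful 1≤c (q-prime , q²∣c))))
  ... | inj₂ sf = begin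
    mobius (p ℕ.* c)      ≡⟨ mobius-squarefree (sf ∘ squareDivisor-*-prime) ⟩
    sign (ω (p ℕ.* c))    ≡⟨ ≡.cong sign (ω-*-prime 1≤c) ⟩
    ℤ.- sign (ω c)        ≡⟨ ≡.cong ℤ.-_ (≡.sym (mobius-squarefree sf)) ⟩
    ℤ.- mobius c          ∎
    where open ≡.≡-Reasoning

module RamanujanSums {c ℓ} (R : CommutativeRing c ℓ) where
  open CommutativeRing R
  open FiniteSums commutativeSemiring public
  open import Algebra.Properties.Semiring.Exp semiring using (_^_; ^-assocʳ; ^-congˡ; ^-homo-*)
  open import Algebra.Properties.Ring ring using (-‿distribʳ-*; [y-z]x≈yx-zx)
  open import Algebra.Properties.AbelianGroup +-abelianGroup using (ε⁻¹≈ε; ⁻¹-involutive; ⁻¹-∙-comm; ∙-cancelʳ; x∙y⁻¹≈ε⇒x≈y)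
  open import Relation.Binary.Reasoning.Setoid setoid
  module + = CommutativeSemigroupProperties +-commutativeSemigroup
  module * = CommutativeSemigroupProperties *-commutativeSemigroup

  ΣR-++ : ∀ {X : Set} (xs ys : List X) (h : X → Carrier) → ΣR R (xs ++ ys) h ≈ ΣR R xs h + ΣR R ys h
  ΣR-++ []       ys h = sym (+-identityˡ _)
  ΣR-++ (x ∷ xs) ys h = trans (+-congˡ (ΣR-++ xs ys h)) (sym (+-assoc _ _ _))

  ΣR-range1 : ∀ n (h : ℕ → Carrier) → ΣR R (range1 n) h ≈ ∑ n h
  ΣR-range1 zero    h = refl
  ΣR-range1 (suc n) h = begin
    ΣR R (range1 (suc n)) h                   ≡⟨ ≡.cong (λ xs → ΣR R xs h) (range1-suc n) ⟩
    ΣR R (range1 n ++ [ suc n ]) h            ≈⟨ ΣR-++ (range1 n) [ suc n ] h ⟩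
    ΣR R (range1 n) h + (h (suc n) + 0#)      ≈⟨ +-cong (ΣR-range1 n h) (+-identityʳ _) ⟩
    ∑ n h + h (suc n)                         ∎

  ΣR-filter : ∀ {X : Set} {p} {P : Pred X p} (P? : Decidable P) (xs : List X) (h : X → Carrier) →
              ΣR R (filter P? xs) h ≈ ΣR R xs (λ x → 𝟙 (P? x) * h x)
  ΣR-filter P? []       h = refl
  ΣR-filter P? (x ∷ xs) h with P? x
  ... | yes _ = +-cong (sym (*-identityˡ _)) (ΣR-filter P? xs h)
  ... | no _  = trans (ΣR-filter P? xs h) (trans (sym (+-identityˡ _)) (+-congʳ (sym (zeroˡ _))))

  ΣR-map : ∀ {X Y : Set} (g : X → Y) (xs : List X) (h : Y → Carrier) → ΣR R (map g xs) h ≈ ΣR R xs (h ∘ g)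
  ΣR-map g []       h = refl
  ΣR-map g (x ∷ xs) h = +-congˡ (ΣR-map g xs h)

  ΣR-const : ∀ {X : Set} (xs : List X) x → ΣR R xs (λ _ → x) ≈ _·ℕ_ R (length xs) x
  ΣR-const []       x = refl
  ΣR-const (_ ∷ xs) x = +-congˡ (ΣR-const xs x)

  ∑-𝟙-const : ∀ {p} {P : ℕ → Set p} (P? : Decidable P) n x →
              ∑[ i ≤ n ] 𝟙 (P? i) * x ≈ _·ℕ_ R (length (filter P? (range1 n))) x
  ∑-𝟙-const P? n x = begin
    ∑[ i ≤ n ] 𝟙 (P? i) * x                 ≈⟨ ΣR-range1 n _ ⟨
    ΣR R (range1 n) (λ i → 𝟙 (P? i) * x)    ≈⟨ ΣR-filter P? (range1 n) _ ⟨
    ΣR R (filter P? (range1 n)) (λ _ → x)   ≈⟨ ΣR-const (filter P? (range1 n)) x ⟩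
    _·ℕ_ R (length (filter P? (range1 n))) x ∎

  ∑-neg : ∀ n (h : ℕ → Carrier) → ∑[ i ≤ n ] - h i ≈ - ∑ n h
  ∑-neg zero    h = sym ε⁻¹≈ε
  ∑-neg (suc n) h = trans (+-congʳ (∑-neg n h)) (⁻¹-∙-comm _ _)

  -- Roots of unity

  pow≡^ : ∀ x n → pow R x n ≡ x ^ n
  pow≡^ x zero    = ≡.refl
  pow≡^ x (suc n) = ≡.cong (x *_) (pow≡^ x n)

  1^n≈1 : ∀ n → 1# ^ n ≈ 1#
  1^n≈1 zero    = refl
  1^n≈1 (suc n) = trans (*-identityˡ _) (1^n≈1 n)

  ^≈1-∣ : ∀ {x k a} → x ^ k ≈ 1# → k ∣ a → x ^ a ≈ 1#
  ^≈1-∣ {x} {k} xᵏ≈1 (divides q ≡.refl) = begin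
    x ^ (q ℕ.* k) ≡⟨ ≡.cong (x ^_) (ℕ.*-comm q k) ⟩
    x ^ (k ℕ.* q) ≈⟨ ^-assocʳ x k q ⟨
    (x ^ k) ^ q   ≈⟨ ^-congˡ q xᵏ≈1 ⟩
    1# ^ q        ≈⟨ 1^n≈1 q ⟩
    1#            ∎

  module _ {ζ k} (ζ-primitive : IsPrimitiveRoot R ζ k) (1≤k : 1 ≤ k) where

    private instance
      k-nonZero : ℕ.NonZero k
      k-nonZero = ℕ.>-nonZero 1≤k

    ζᵏ≈1 : ζ ^ k ≈ 1#
    ζᵏ≈1 = trans (reflexive (≡.sym (pow≡^ ζ k))) (proj₁ ζ-primitive)

    ζ^d≉1 : ∀ {d} → 0 < d → d < k → ¬ ζ ^ d ≈ 1#
    ζ^d≉1 {d} 0<d d<k ζᵈ≈1 = proj₂ ζ-primitive d 0<d d<k (trans (reflexive (pow≡^ ζ d)) ζᵈ≈1)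

    primitive⇒order∣ : ∀ a → ζ ^ a ≈ 1# → k ∣ a
    primitive⇒order∣ a ζᵃ≈1 with a % k ≟ 0
    ... | yes r≡0 = m%n≡0⇒n∣m a k r≡0
    ... | no r≢0  = contradiction ζʳ≈1 (ζ^d≉1 (ℕ.n≢0⇒n>0 r≢0) (m%n<n a k))
      where
      ζʳ≈1 : ζ ^ (a % k) ≈ 1#
      ζʳ≈1 = begin
        ζ ^ (a % k)                       ≈⟨ *-identityʳ _ ⟨
        ζ ^ (a % k) * 1#                  ≈⟨ *-congˡ (^≈1-∣ ζᵏ≈1 (n∣m*n (a / k))) ⟨
        ζ ^ (a % k) * ζ ^ (a / k ℕ.* k)   ≈⟨ ^-homo-* ζ (a % k) _ ⟨
        ζ ^ (a % k ℕ.+ a / k ℕ.* k)       ≡⟨ ≡.cong (ζ ^_) (m≡m%n+[m/n]*n a k) ⟨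
        ζ ^ a                             ≈⟨ ζᵃ≈1 ⟩
        1#                                ∎

    primitive-^-coprime : ∀ {m} → Coprime m k → IsPrimitiveRoot R (ζ ^ m) k
    primitive-^-coprime {m} m⊥k = ζᵐ-order , ζᵐ-not-earlier
      where
      ζᵐ-order : pow R (ζ ^ m) k ≈ 1#
      ζᵐ-order = begin
        pow R (ζ ^ m) k  ≡⟨ pow≡^ (ζ ^ m) k ⟩
        (ζ ^ m) ^ k      ≈⟨ ^-assocʳ ζ m k ⟩
        ζ ^ (m ℕ.* k)    ≈⟨ ^≈1-∣ ζᵏ≈1 (n∣m*n m) ⟩
        1#               ∎
      ζᵐ-not-earlier : ∀ d → 0 < d → d < k → ¬ pow R (ζ ^ m) d ≈ 1#
      ζᵐ-not-earlier d 0<d d<k ζᵐᵈ≈1 = ℕ.<⇒≱ d<k (∣⇒≤ ⦃ ℕ.>-nonZero 0<d ⦄ k∣d)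
        where
        k∣d : k ∣ d
        k∣d = coprime-divisor (Coprime.sym m⊥k) (primitive⇒order∣ (m ℕ.* d)
                (trans (sym (^-assocʳ ζ m d)) (trans (reflexive (≡.sym (pow≡^ (ζ ^ m) d))) ζᵐᵈ≈1)))

  geometric-shift : ∀ η n → η * ∑ n (η ^_) + η ≈ ∑ (suc n) (η ^_)
  geometric-shift η zero    = trans (+-congʳ (zeroʳ η)) (+-congˡ (sym (*-identityʳ η)))
  geometric-shift η (suc n) = begin
    η * (∑ n (η ^_) + η ^ suc n) + η         ≈⟨ +-congʳ (distribˡ η _ _) ⟩
    η * ∑ n (η ^_) + η ^ suc (suc n) + η     ≈⟨ +.xy∙z≈xz∙y _ _ _ ⟩
    η * ∑ n (η ^_) + η + η ^ suc (suc n)     ≈⟨ +-congʳ (geometric-shift η n) ⟩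
    ∑ (suc (suc n)) (η ^_)                   ∎

  module _ (noZeroDivisors : NoZeroDivisors R) where

    ∑-^-root-of-unity : ∀ {η} n → η ^ n ≈ 1# → ¬ η ≈ 1# → ∑[ i ≤ n ] η ^ i ≈ 0#
    ∑-^-root-of-unity {η} n ηⁿ≈1 η≉1 with noZeroDivisors (η - 1#) G [η-1]G≈0
      where
      G = ∑ n (η ^_)
      ηG≈G : η * G ≈ G
      ηG≈G = ∙-cancelʳ η _ _ (trans (geometric-shift η n) (+-congˡ (trans (*-congˡ ηⁿ≈1) (*-identityʳ η))))
      [η-1]G≈0 : (η - 1#) * G ≈ 0#
      [η-1]G≈0 = trans ([y-z]x≈yx-zx G η 1#) (trans (+-cong ηG≈G (-‿cong (*-identityˡ G))) (-‿inverseʳ G))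
    ... | inj₁ η-1≈0 = contradiction (x∙y⁻¹≈ε⇒x≈y η 1# η-1≈0) η≉1
    ... | inj₂ G≈0   = G≈0

    ∑-^-multiples : ∀ {ξ k d} → IsPrimitiveRoot R ξ k → 1 ≤ k → 1 ≤ d → d ∣ k →
                    ∑[ j ≤ k ] 𝟙 (d ∣? j) * ξ ^ j ≈ 𝟙 (d ≟ k)
    ∑-^-multiples {ξ} {k} {d} ξ-primitive 1≤k 1≤d d∣k@(divides q k≡qd) = begin
      ∑[ j ≤ k ] 𝟙 (d ∣? j) * ξ ^ j          ≈⟨ ∑-≡ _ k≡qd ⟩
      ∑[ j ≤ q ℕ.* d ] 𝟙 (d ∣? j) * ξ ^ j    ≈⟨ ∑-multiples q _ 1≤d ⟩
      ∑[ c ≤ q ] ξ ^ (c ℕ.* d)              ≈⟨ ∑-cong q (λ c _ _ → ξ^[cd]≈[ξ^d]^c c) ⟩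
      ∑[ c ≤ q ] (ξ ^ d) ^ c                ≈⟨ value (d ≟ k) ⟩
      𝟙 (d ≟ k)                             ∎
      where
      ξ^[cd]≈[ξ^d]^c : ∀ c → ξ ^ (c ℕ.* d) ≈ (ξ ^ d) ^ c
      ξ^[cd]≈[ξ^d]^c c = trans (reflexive (≡.cong (ξ ^_) (ℕ.*-comm c d))) (sym (^-assocʳ ξ d c))
      value : (d≟k : Dec (d ≡ k)) → ∑[ c ≤ q ] (ξ ^ d) ^ c ≈ 𝟙 d≟k
      value (yes ≡.refl) = begin
        ∑[ c ≤ q ] (ξ ^ k) ^ c   ≈⟨ ∑-≡ _ q≡1 ⟩
        0# + (ξ ^ k) * 1#        ≈⟨ trans (+-identityˡ _) (*-identityʳ _) ⟩
        ξ ^ k                    ≈⟨ ζᵏ≈1 ξ-primitive 1≤k ⟩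
        1#                       ∎
        where
        q≡1 : q ≡ 1
        q≡1 = ℕ.*-cancelʳ-≡ q 1 k ⦃ ℕ.>-nonZero 1≤k ⦄ (≡.trans (≡.sym k≡qd) (≡.sym (ℕ.*-identityˡ k)))
      value (no d≢k) = ∑-^-root-of-unity q ηᵠ≈1 (ζ^d≉1 ξ-primitive 1≤k 1≤d d<k)
        where
        d<k = ℕ.≤∧≢⇒< (∣⇒≤ ⦃ ℕ.>-nonZero 1≤k ⦄ d∣k) d≢k
        ηᵠ≈1 : (ξ ^ d) ^ q ≈ 1#
        ηᵠ≈1 = trans (sym (ξ^[cd]≈[ξ^d]^c q)) (trans (reflexive (≡.cong (ξ ^_) (≡.sym k≡qd))) (ζᵏ≈1 ξ-primitive 1≤k))

  -- Möbius inversion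

  μ : ℕ → Carrier
  μ n = ιℤ R (mobius n)

  ιℤ-neg : ∀ z → ιℤ R (ℤ.- z) ≈ - ιℤ R z
  ιℤ-neg (+ zero)  = sym ε⁻¹≈ε
  ιℤ-neg (+ suc n) = refl
  ιℤ-neg -[1+ n ]  = sym (⁻¹-involutive _)

  μ-*-prime : ∀ {p c} → Prime p → 1 ≤ c → (p∣?c : Dec (p ∣ c)) → μ (p ℕ.* c) ≈ - (𝟙 (¬? p∣?c) * μ c)
  μ-*-prime {p} {c} p-prime 1≤c (yes p∣c) = begin
    μ (p ℕ.* c)            ≡⟨ ≡.cong (ιℤ R) (mobius-*-∣ p-prime p∣c 1≤c) ⟩
    0#                     ≈⟨ ε⁻¹≈ε ⟨
    - 0#                   ≈⟨ -‿cong (zeroˡ (μ c)) ⟨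
    - (0# * μ c)           ∎
  μ-*-prime {p} {c} p-prime 1≤c (no p∤c)  = begin
    μ (p ℕ.* c)            ≡⟨ ≡.cong (ιℤ R) (mobius-*-prime p-prime p∤c 1≤c) ⟩
    ιℤ R (ℤ.- mobius c)    ≈⟨ ιℤ-neg (mobius c) ⟩
    - μ c                  ≈⟨ -‿cong (*-identityˡ (μ c)) ⟨
    - (1# * μ c)           ∎

  -- For a prime p, μ (p c) = -[p ∤ c] μ c pairs each divisor c p of M p with the divisor c of M,
  -- so the divisors divisible by p cancel those prime to p.
  module _ {p M} (p-prime : Prime p) (1≤M : 1 ≤ M) where

    private
      N = M ℕ.* p
      coprimeDivisorSum : Carrier
      coprimeDivisorSum = ∑[ c ≤ M ] 𝟙 (¬? (p ∣? c)) * (𝟙 (c ∣? M) * μ c)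

    ∑-μ-divisors-coprime : ∑[ c ≤ N ] 𝟙 (¬? (p ∣? c)) * (𝟙 (c ∣? N) * μ c) ≈ coprimeDivisorSum
    ∑-μ-divisors-coprime = trans (∑-cong N (λ c _ _ → same-divisors c (p ∣? c)))
                                 (∑-truncate _ M≤N (λ c M<c → trans (*-congˡ (𝟙-*-no (c ∣? M) (>⇒∤ ⦃ ℕ.>-nonZero 1≤M ⦄ M<c) _)) (zeroʳ _)))
      where
      M≤N : M ≤ N
      M≤N = ℕ.m≤m*n M p ⦃ prime⇒nonZero p-prime ⦄
      same-divisors : ∀ c (p∣?c : Dec (p ∣ c)) →
                      𝟙 (¬? p∣?c) * (𝟙 (c ∣? N) * μ c) ≈ 𝟙 (¬? p∣?c) * (𝟙 (c ∣? M) * μ c)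
      same-divisors c (yes _)  = trans (zeroˡ _) (sym (zeroˡ _))
      same-divisors c (no p∤c) = *-congˡ (*-congʳ (𝟙-cong (c ∣? N) (c ∣? M)
        (λ c∣N → coprime-divisor (Coprime.sym (prime∤⇒coprime p-prime p∤c)) (≡.subst (c ∣_) (ℕ.*-comm M p) c∣N))
        (∣m⇒∣m*n p)))

    ∑-μ-divisors-multiple : ∑[ c ≤ N ] 𝟙 (p ∣? c) * (𝟙 (c ∣? N) * μ c) ≈ - coprimeDivisorSum
    ∑-μ-divisors-multiple = begin
      ∑[ c ≤ N ] 𝟙 (p ∣? c) * (𝟙 (c ∣? N) * μ c)                ≈⟨ ∑-multiples M _ (prime⇒1≤ p-prime) ⟩
      ∑[ c ≤ M ] 𝟙 (c ℕ.* p ∣? N) * μ (c ℕ.* p)                ≈⟨ ∑-cong M (λ c 1≤c _ → term c 1≤c) ⟩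
      ∑[ c ≤ M ] - (𝟙 (¬? (p ∣? c)) * (𝟙 (c ∣? M) * μ c))      ≈⟨ ∑-neg M _ ⟩
      - coprimeDivisorSum                                     ∎
      where
      term : ∀ c → 1 ≤ c → 𝟙 (c ℕ.* p ∣? N) * μ (c ℕ.* p) ≈ - (𝟙 (¬? (p ∣? c)) * (𝟙 (c ∣? M) * μ c))
      term c 1≤c = begin
        𝟙 (c ℕ.* p ∣? N) * μ (c ℕ.* p)                     ≈⟨ *-cong (𝟙-cong (c ℕ.* p ∣? N) (c ∣? M)
                                                                  (*-cancelʳ-∣ p ⦃ prime⇒nonZero p-prime ⦄) (*-monoˡ-∣ p))
                                                                (reflexive (≡.cong μ (ℕ.*-comm c p))) ⟩
        𝟙 (c ∣? M) * μ (p ℕ.* c)                           ≈⟨ *-congˡ (μ-*-prime p-prime 1≤c (p ∣? c)) ⟩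
        𝟙 (c ∣? M) * - (𝟙 (¬? (p ∣? c)) * μ c)            ≈⟨ -‿distribʳ-* _ _ ⟨
        - (𝟙 (c ∣? M) * (𝟙 (¬? (p ∣? c)) * μ c))          ≈⟨ -‿cong (*.x∙yz≈y∙xz _ _ _) ⟩
        - (𝟙 (¬? (p ∣? c)) * (𝟙 (c ∣? M) * μ c))          ∎

    ∑-μ-divisors-*-prime : ∑[ c ≤ N ] 𝟙 (c ∣? N) * μ c ≈ 0#
    ∑-μ-divisors-*-prime = begin
      ∑[ c ≤ N ] 𝟙 (c ∣? N) * μ c
        ≈⟨ ∑-cong N (λ c _ _ → 𝟙-split (p ∣? c) _) ⟩
      ∑[ c ≤ N ] (𝟙 (p ∣? c) * (𝟙 (c ∣? N) * μ c) + 𝟙 (¬? (p ∣? c)) * (𝟙 (c ∣? N) * μ c))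
        ≈⟨ ∑-distrib-+ N _ _ ⟩
      (∑[ c ≤ N ] 𝟙 (p ∣? c) * (𝟙 (c ∣? N) * μ c)) + (∑[ c ≤ N ] 𝟙 (¬? (p ∣? c)) * (𝟙 (c ∣? N) * μ c))
        ≈⟨ +-cong ∑-μ-divisors-multiple ∑-μ-divisors-coprime ⟩
      - coprimeDivisorSum + coprimeDivisorSum
        ≈⟨ -‿inverseˡ _ ⟩
      0# ∎

  ∑-μ-divisors : ∀ n → 1 ≤ n → ∑[ c ≤ n ] 𝟙 (c ∣? n) * μ c ≈ 𝟙 (n ≟ 1)
  ∑-μ-divisors (suc zero)    _ = trans (+-identityˡ _) (trans (*-identityˡ _) (+-identityʳ 1#))
  ∑-μ-divisors (suc (suc n)) _ with ∃-prime-divisor n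
  ... | p , p-prime , divides M n≡Mp =
    ≡.subst (λ N → ∑[ c ≤ N ] 𝟙 (c ∣? N) * μ c ≈ 0#) (≡.sym n≡Mp)
            (∑-μ-divisors-*-prime {M = M} p-prime (quotient-pos (s≤s z≤n) n≡Mp))

  module MobiusInversion (f : ℕ → Carrier) where

    -- The value at e = 0 is junk; sums start at e = 1.
    mobiusTerm : ℕ → ℕ → Carrier
    mobiusTerm d zero    = 0#
    mobiusTerm d (suc e) = μ (d / suc e) * f (suc e)

    μ∗f : ℕ → Carrier
    μ∗f d = ∑[ e ≤ d ] 𝟙 (e ∣? d) * mobiusTerm d e

    μ∗f≈mobiusConv : ∀ k → μ∗f k ≈ mobiusConv R f k
    μ∗f≈mobiusConv k = begin
      μ∗f k                                                          ≈⟨ ΣR-range1 k _ ⟨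
      ΣR R (range1 k) (λ e → 𝟙 (e ∣? k) * mobiusTerm k e)            ≈⟨ ΣR-map suc (upTo k) _ ⟩
      ΣR R (upTo k) (λ i → 𝟙 (suc i ∣? k) * mobiusTerm k (suc i))    ≈⟨ ΣR-filter (λ i → suc i ∣? k) (upTo k) _ ⟨
      mobiusConv R f k                                               ∎

    mobiusTerm-* : ∀ c {e} → 1 ≤ e → mobiusTerm (c ℕ.* e) e ≈ μ c * f e
    mobiusTerm-* c {suc e} _ = *-congʳ (reflexive (≡.cong μ (m*n/n≡m c (suc e))))

    ∑-intermediate-divisors : ∀ {n e} → 1 ≤ n → 1 ≤ e →
      ∑[ d ≤ n ] 𝟙 (d ∣? n) * (𝟙 (e ∣? d) * mobiusTerm d e) ≈ 𝟙 (e ≟ n) * f e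
    ∑-intermediate-divisors {n} {e} 1≤n 1≤e with e ∣? n
    ... | no e∤n = trans (∑-zero n (λ d _ _ → vanish d (d ∣? n)))
                         (sym (𝟙-*-no (e ≟ n) (e∤n ∘ ∣-reflexive) (f e)))
      where
      vanish : ∀ d (d∣?n : Dec (d ∣ n)) → 𝟙 d∣?n * (𝟙 (e ∣? d) * mobiusTerm d e) ≈ 0#
      vanish d (no _)    = zeroˡ _
      vanish d (yes d∣n) = trans (*-identityˡ _) (𝟙-*-no (e ∣? d) (λ e∣d → e∤n (∣-trans e∣d d∣n)) _)
    ... | yes (divides q n≡qe) = begin
      ∑[ d ≤ n ] 𝟙 (d ∣? n) * (𝟙 (e ∣? d) * mobiusTerm d e)          ≈⟨ ∑-cong n (λ d _ _ → *.x∙yz≈y∙xz _ _ _) ⟩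
      ∑[ d ≤ n ] 𝟙 (e ∣? d) * (𝟙 (d ∣? n) * mobiusTerm d e)          ≈⟨ ∑-≡ _ n≡qe ⟩
      ∑[ d ≤ q ℕ.* e ] 𝟙 (e ∣? d) * (𝟙 (d ∣? n) * mobiusTerm d e)    ≈⟨ ∑-multiples q _ 1≤e ⟩
      ∑[ c ≤ q ] 𝟙 (c ℕ.* e ∣? n) * mobiusTerm (c ℕ.* e) e           ≈⟨ ∑-cong q (λ c _ _ → term c) ⟩
      ∑[ c ≤ q ] 𝟙 (c ∣? q) * μ c * f e                             ≈⟨ *-distribʳ-∑ q (f e) _ ⟨
      (∑[ c ≤ q ] 𝟙 (c ∣? q) * μ c) * f e                           ≈⟨ *-congʳ (∑-μ-divisors q (quotient-pos 1≤n n≡qe)) ⟩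
      𝟙 (q ≟ 1) * f e                                              ≈⟨ *-congʳ (𝟙-cong (q ≟ 1) (e ≟ n) q≡1⇒e≡n e≡n⇒q≡1) ⟩
      𝟙 (e ≟ n) * f e                                              ∎
      where
      q≡1⇒e≡n : q ≡ 1 → e ≡ n
      q≡1⇒e≡n ≡.refl = ≡.sym (≡.trans n≡qe (ℕ.*-identityˡ e))
      e≡n⇒q≡1 : e ≡ n → q ≡ 1
      e≡n⇒q≡1 e≡n = ≡.sym (ℕ.*-cancelʳ-≡ 1 q e ⦃ ℕ.>-nonZero 1≤e ⦄ (≡.trans (ℕ.*-identityˡ e) (≡.trans e≡n n≡qe)))
      term : ∀ c → 𝟙 (c ℕ.* e ∣? n) * mobiusTerm (c ℕ.* e) e ≈ 𝟙 (c ∣? q) * μ c * f e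
      term c = trans (*-cong (𝟙-cong (c ℕ.* e ∣? n) (c ∣? q)
                                (λ ce∣n → *-cancelʳ-∣ e ⦃ ℕ.>-nonZero 1≤e ⦄ (≡.subst (c ℕ.* e ∣_) n≡qe ce∣n))
                                (λ c∣q → ≡.subst (c ℕ.* e ∣_) (≡.sym n≡qe) (*-monoˡ-∣ e c∣q)))
                             (mobiusTerm-* c 1≤e))
                     (sym (*-assoc _ _ _))

    inversion : ∀ n → 1 ≤ n → f n ≈ ∑[ d ≤ n ] 𝟙 (d ∣? n) * μ∗f d
    inversion n@(suc n′) 1≤n = sym (begin
      ∑[ d ≤ n ] 𝟙 (d ∣? n) * μ∗f d
        ≈⟨ ∑-cong n (λ d 1≤d d≤n → *-congˡ (sym (∑-divisors-truncate _ 1≤d d≤n))) ⟩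
      ∑[ d ≤ n ] 𝟙 (d ∣? n) * (∑[ e ≤ n ] 𝟙 (e ∣? d) * mobiusTerm d e)
        ≈⟨ ∑-cong n (λ d _ _ → *-distribˡ-∑ n _ _) ⟩
      ∑[ d ≤ n ] ∑[ e ≤ n ] 𝟙 (d ∣? n) * (𝟙 (e ∣? d) * mobiusTerm d e)
        ≈⟨ ∑-comm n n _ ⟩
      ∑[ e ≤ n ] ∑[ d ≤ n ] 𝟙 (d ∣? n) * (𝟙 (e ∣? d) * mobiusTerm d e)
        ≈⟨ ∑-cong n (λ e 1≤e _ → ∑-intermediate-divisors 1≤n 1≤e) ⟩
      ∑[ e ≤ n ] 𝟙 (e ≟ n) * f e
        ≈⟨ ∑-delta n′ f ⟩
      f n ∎)

    f-gcd≈∑-common-divisors : ∀ j {k} → 1 ≤ k → f (gcd j k) ≈ ∑[ d ≤ k ] 𝟙 (d ∣? j) * (𝟙 (d ∣? k) * μ∗f d)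
    f-gcd≈∑-common-divisors j {k} 1≤k = begin
      f g                                              ≈⟨ inversion g 1≤g ⟩
      ∑[ d ≤ g ] 𝟙 (d ∣? g) * μ∗f d                    ≈⟨ ∑-divisors-truncate μ∗f 1≤g (∣⇒≤ ⦃ ℕ.>-nonZero 1≤k ⦄ (gcd[m,n]∣n j k)) ⟨
      ∑[ d ≤ k ] 𝟙 (d ∣? g) * μ∗f d                    ≈⟨ ∑-cong k (λ d _ _ → common-divisor d) ⟩
      ∑[ d ≤ k ] 𝟙 (d ∣? j) * (𝟙 (d ∣? k) * μ∗f d)     ∎
      where
      g = gcd j k
      1≤g : 1 ≤ g
      1≤g = ℕ.n≢0⇒n>0 (gcd[m,n]≢0 j k (inj₂ (ℕ.≢-nonZero⁻¹ k ⦃ ℕ.>-nonZero 1≤k ⦄)))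
      common-divisor : ∀ d → 𝟙 (d ∣? g) * μ∗f d ≈ 𝟙 (d ∣? j) * (𝟙 (d ∣? k) * μ∗f d)
      common-divisor d = begin
        𝟙 (d ∣? g) * μ∗f d                  ≈⟨ *-congʳ (𝟙-cong (d ∣? g) ((d ∣? j) ×-dec (d ∣? k))
                                                 (λ d∣g → ∣-trans d∣g (gcd[m,n]∣m j k) , ∣-trans d∣g (gcd[m,n]∣n j k))
                                                 (λ (d∣j , d∣k) → gcd-greatest d∣j d∣k)) ⟩
        𝟙 ((d ∣? j) ×-dec (d ∣? k)) * μ∗f d  ≈⟨ *-congʳ (𝟙-× (d ∣? j) (d ∣? k)) ⟩
        𝟙 (d ∣? j) * 𝟙 (d ∣? k) * μ∗f d     ≈⟨ *-assoc _ _ _ ⟩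
        𝟙 (d ∣? j) * (𝟙 (d ∣? k) * μ∗f d)   ∎

  -- Gcd sums twisted by roots of unity

  module _ (noZeroDivisors : NoZeroDivisors R) (f : ℕ → Carrier) where
    open MobiusInversion f

    ∑-gcd-^ : ∀ {ξ k} → IsPrimitiveRoot R ξ k → 1 ≤ k → ∑[ j ≤ k ] f (gcd j k) * ξ ^ j ≈ μ∗f k
    ∑-gcd-^ {ξ} {k@(suc k′)} ξ-primitive 1≤k = begin
      ∑[ j ≤ k ] f (gcd j k) * ξ ^ j
        ≈⟨ ∑-cong k (λ j _ _ → *-congʳ (f-gcd≈∑-common-divisors j 1≤k)) ⟩
      ∑[ j ≤ k ] (∑[ d ≤ k ] 𝟙 (d ∣? j) * (𝟙 (d ∣? k) * μ∗f d)) * ξ ^ j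
        ≈⟨ ∑-cong k (λ j _ _ → *-distribʳ-∑ k _ _) ⟩
      ∑[ j ≤ k ] ∑[ d ≤ k ] 𝟙 (d ∣? j) * (𝟙 (d ∣? k) * μ∗f d) * ξ ^ j
        ≈⟨ ∑-comm k k _ ⟩
      ∑[ d ≤ k ] ∑[ j ≤ k ] 𝟙 (d ∣? j) * (𝟙 (d ∣? k) * μ∗f d) * ξ ^ j
        ≈⟨ ∑-cong k (λ d _ _ → ∑-cong k (λ j _ _ → *.xy∙z≈y∙xz _ _ _)) ⟩
      ∑[ d ≤ k ] ∑[ j ≤ k ] (𝟙 (d ∣? k) * μ∗f d) * (𝟙 (d ∣? j) * ξ ^ j)
        ≈⟨ ∑-cong k (λ d _ _ → *-distribˡ-∑ k _ _) ⟨
      ∑[ d ≤ k ] (𝟙 (d ∣? k) * μ∗f d) * (∑[ j ≤ k ] 𝟙 (d ∣? j) * ξ ^ j)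
        ≈⟨ ∑-cong k (λ d 1≤d _ → only-k (d ∣? k) 1≤d) ⟩
      ∑[ d ≤ k ] 𝟙 (d ≟ k) * μ∗f d
        ≈⟨ ∑-delta k′ μ∗f ⟩
      μ∗f k ∎
      where
      only-k : ∀ {d} (d∣?k : Dec (d ∣ k)) → 1 ≤ d →
               (𝟙 d∣?k * μ∗f d) * (∑[ j ≤ k ] 𝟙 (d ∣? j) * ξ ^ j) ≈ 𝟙 (d ≟ k) * μ∗f d
      only-k (yes d∣k) 1≤d = trans (*-cong (*-identityˡ _) (∑-^-multiples noZeroDivisors ξ-primitive 1≤k 1≤d d∣k)) (*-comm _ _)
      only-k {d} (no d∤k) _ = trans (trans (*-congʳ (zeroˡ _)) (zeroˡ _)) (sym (𝟙-*-no (d ≟ k) (d∤k ∘ ∣-reflexive) _))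

    ∑-gcd-ramanujan : ∀ {ζ k} → IsPrimitiveRoot R ζ k → 1 ≤ k →
                      ∑[ j ≤ k ] f (gcd j k) * ramanujan R ζ k j ≈ ∑[ m ≤ k ] 𝟙 (gcd m k ≟ 1) * μ∗f k
    ∑-gcd-ramanujan {ζ} {k} ζ-primitive 1≤k = begin
      ∑[ j ≤ k ] f (gcd j k) * ramanujan R ζ k j
        ≈⟨ ∑-cong k (λ j _ _ → *-congˡ (ramanujan≈∑ j)) ⟩
      ∑[ j ≤ k ] f (gcd j k) * (∑[ m ≤ k ] 𝟙 (gcd m k ≟ 1) * ζ ^ (m ℕ.* j))
        ≈⟨ ∑-cong k (λ j _ _ → *-distribˡ-∑ k _ _) ⟩
      ∑[ j ≤ k ] ∑[ m ≤ k ] f (gcd j k) * (𝟙 (gcd m k ≟ 1) * ζ ^ (m ℕ.* j))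
        ≈⟨ ∑-comm k k _ ⟩
      ∑[ m ≤ k ] ∑[ j ≤ k ] f (gcd j k) * (𝟙 (gcd m k ≟ 1) * ζ ^ (m ℕ.* j))
        ≈⟨ ∑-cong k (λ m _ _ → ∑-cong k (λ j _ _ → *.x∙yz≈y∙xz _ _ _)) ⟩
      ∑[ m ≤ k ] ∑[ j ≤ k ] 𝟙 (gcd m k ≟ 1) * (f (gcd j k) * ζ ^ (m ℕ.* j))
        ≈⟨ ∑-cong k (λ m _ _ → *-distribˡ-∑ k _ _) ⟨
      ∑[ m ≤ k ] 𝟙 (gcd m k ≟ 1) * (∑[ j ≤ k ] f (gcd j k) * ζ ^ (m ℕ.* j))
        ≈⟨ ∑-cong k (λ m _ _ → coprime-only m (gcd m k ≟ 1)) ⟩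
      ∑[ m ≤ k ] 𝟙 (gcd m k ≟ 1) * μ∗f k ∎
      where
      ramanujan≈∑ : ∀ j → ramanujan R ζ k j ≈ ∑[ m ≤ k ] 𝟙 (gcd m k ≟ 1) * ζ ^ (m ℕ.* j)
      ramanujan≈∑ j = trans (ΣR-filter (λ m → gcd m k ≟ 1) (range1 k) _)
                     (trans (ΣR-range1 k _) (∑-cong k (λ m _ _ → *-congˡ (reflexive (pow≡^ ζ (m ℕ.* j))))))
      coprime-only : ∀ m (m⊥?k : Dec (gcd m k ≡ 1)) →
                     𝟙 m⊥?k * (∑[ j ≤ k ] f (gcd j k) * ζ ^ (m ℕ.* j)) ≈ 𝟙 m⊥?k * μ∗f k
      coprime-only _ (no _)    = trans (zeroˡ _) (sym (zeroˡ _))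
      coprime-only m (yes m⊥k) = *-congˡ (trans
        (∑-cong k (λ j _ _ → *-congˡ (sym (^-assocʳ ζ m j))))
        (∑-gcd-^ (primitive-^-coprime ζ-primitive 1≤k (gcd≡1⇒coprime {m} m⊥k)) 1≤k))

proposition3 : {c ℓ : Level} (R : CommutativeRing c ℓ) → NoZeroDivisors R →
                 (ζ : CommutativeRing.Carrier R) (k : ℕ) → 1 ≤ k → IsPrimitiveRoot R ζ k →
                 (f : ℕ → CommutativeRing.Carrier R) →
                 CommutativeRing._≈_ R
                   (ΣR R (range1 k) (λ j → CommutativeRing._*_ R (f (gcd j k)) (ramanujan R ζ k j)))
                   (_·ℕ_ R (totient k) (mobiusConv R f k))
proposition3 R noZeroDivisors ζ k 1≤k ζ-primitive f = begin
  ΣR R (range1 k) (λ j → f (gcd j k) * ramanujan R ζ k j) ≈⟨ ΣR-range1 k _ ⟩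
  ∑[ j ≤ k ] f (gcd j k) * ramanujan R ζ k j              ≈⟨ ∑-gcd-ramanujan noZeroDivisors f ζ-primitive 1≤k ⟩
  ∑[ m ≤ k ] 𝟙 (gcd m k ≟ 1) * μ∗f k                      ≈⟨ ∑-cong k (λ _ _ _ → *-congˡ (μ∗f≈mobiusConv k)) ⟩
  ∑[ m ≤ k ] 𝟙 (gcd m k ≟ 1) * mobiusConv R f k          ≈⟨ ∑-𝟙-const (λ m → gcd m k ≟ 1) k _ ⟩
  _·ℕ_ R (totient k) (mobiusConv R f k)                  ∎
  where
  open CommutativeRing R
  open RamanujanSums R
  open MobiusInversion f
  open import Relation.Binary.Reasoning.Setoid setoid
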